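{- Let $m$ be a prime and let $n\in\mathbb{N}\setminus\mathbb{P}$ with $n\neq 0$. Then $g_m(\overline{g_m}(n))=n$.
   Context: $\mathbb{N}=\{0,1,2,\dots\}$, $\mathbb{P}$ is the set of prime numbers. For an integer $m\ge 2$, an $m$-product sequence is a finite sequence of integers $a_1\le a_2\le\dots\le a_t$ such that $\prod_{i=1}^t a_i=R^m$ for some $R\in\mathbb{N}$ and no integer appears more than $m-1$ times in the sequence. For $n\in\mathbb{N}$, $g_m(n)$ is the least integer $s$ such that there exists an $m$-product sequence $a_1\le\dots\le a_t$ with $a_1=n$ and $a_t=s$. For $n\in\mathbb{N}$, $\overline{g_m}(n)$ is the greatest integer $k$ such that there exists an $m$-product sequence $a_1\le\dots\le a_t$ with $a_1=k$ and $a_t=n$. -}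

module Defs where

open import Data.Nat using (ℕ; _≤_; _<_; _^_; _≟_)
open import Data.List using (List; length; filter; head; last)
open import Data.Nat.ListAction using (product)
open import Data.List.Relation.Unary.Linked using (Linked)
open import Data.Maybe using (just)
open import Data.Product using (∃; _×_)
open import Relation.Binary.PropositionalEquality using (_≡_)

occ : ℕ → List ℕ → ℕ
occ x xs = length (filter (x ≟_) xs)

record IsProdSeq (m : ℕ) (xs : List ℕ) : Set where
  field
    sorted : Linked _≤_ xs
    power  : ∃ λ R → product xs ≡ R ^ m
    mult   : ∀ x → occ x xs < m

SeqFromTo : ℕ → ℕ → ℕ → Set
SeqFromTo m a b = ∃ λ xs → IsProdSeq m xs × (head xs ≡ just a) × (last xs ≡ just b)

IsG : ℕ → ℕ → ℕ → Set
IsG m n s = SeqFromTo m n s × (∀ s′ → SeqFromTo m n s′ → s ≤ s′)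

IsGbar : ℕ → ℕ → ℕ → Set
IsGbar m n k = SeqFromTo m k n × (∀ k′ → SeqFromTo m k′ n → k′ ≤ k)

module Submission where

-- Let k be the largest start of an m-product sequence ending at n. It exists: the question is decidable
-- by a bounded search, and a start k₀ ≥ 1 is supplied by reducing the list n, q^(m-1), d^(m-1) (for
-- n = q d) or [1]. Suppose some sequence A from k ended at s < n, and let B run from k to n. Taking c₁
-- copies of B and m - c₂ copies of A (c₁, c₂ the multiplicities of k in A and B) gives a list whose
-- product is an m-th power, in which k occurs a multiple of m times and n a number of times not divisible
-- by the prime m. Reducing every multiplicity mod m removes only an m-th power from the product, so the
-- result is an m-product sequence from some k′ > k to n, contradicting maximality. Hence g_m(k) = n.

open import Defs
open import Data.Nat
open import Data.Nat.Properties
open import Algebra.Properties.CommutativeSemigroup *-commutativeSemigroup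
  using () renaming (interchange to *-interchange)
open import Algebra.Properties.CommutativeSemigroup +-commutativeSemigroup
  using () renaming (interchange to +-interchange)
open import Data.List using (List; []; _∷_; _++_; concat; replicate; length; filter; head; last)
open import Data.List.Membership.Propositional using (_∈_; _∉_)
open import Data.List.Membership.DecPropositional _≟_ using (_∈?_)
open import Data.List.Properties using (filter-accept; filter-reject; filter-++; length-++)
open import Data.List.Relation.Unary.All as All using (All; []; _∷_)
import Data.List.Relation.Unary.All.Properties as All
open import Data.List.Relation.Unary.AllPairs using (AllPairs; []; _∷_)
import Data.List.Relation.Unary.AllPairs.Properties as AllPairs
open import Data.List.Relation.Unary.Any using (here; there)
open import Data.List.Relation.Unary.Linked using (Linked; []; [-]; _∷_; linked?)
open import Data.List.Relation.Unary.Linked.Properties using (AllPairs⇒Linked; Linked⇒AllPairs)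
open import Data.Maybe using (just)
open import Data.Maybe.Properties using (just-injective; ≡-dec)
open import Data.Nat.Coprimality using (Coprime; coprime-/gcd; coprime-divisor)
open import Data.Nat.DivMod using (m≡m%n+[m/n]*n; m/n*n≡m; m%n<n; 0/n≡0; m*n%n≡0; m<n⇒m%n≡m)
open import Data.Nat.Divisibility
  using (_∣_; divides; ∣-trans; m∣m*n; ∣1⇒≡1; ∣⇒≤; m%n≡0⇒n∣m; quotient>1; quotient-<)
open import Data.Nat.Divisibility.Core using (hasNonTrivialDivisor)
open import Data.Nat.GCD using (gcd; gcd[m,n]∣m; gcd[m,n]∣n; gcd[m,n]≢0)
open import Data.Nat.ListAction using (product)
open import Data.Nat.ListAction.Properties using (product-++)
open import Data.Nat.Primality using (Prime; euclidsLemma; prime⇒nonZero; prime⇒nonTrivial; ¬prime⇒composite)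
open import Data.Product using (∃; _×_; _,_; proj₁; proj₂)
open import Data.Sum using (inj₁; inj₂)
open import Function using (_∘_)
open import Relation.Binary.PropositionalEquality
open import Relation.Nullary using (¬_; Dec; yes; no; contradiction)
open import Relation.Nullary.Decidable using (_×-dec_; map′)

-- Multiplicities

δ : ℕ → ℕ → ℕ
δ x y with x ≟ y
... | yes _ = 1
... | no  _ = 0

δ-diag : ∀ x → δ x x ≡ 1
δ-diag x with x ≟ x
... | yes _  = refl
... | no x≢x = contradiction refl x≢x

δ-≢ : ∀ {x y} → x ≢ y → δ x y ≡ 0
δ-≢ {x} {y} x≢y with x ≟ y
... | yes x≡y = contradiction x≡y x≢y
... | no  _   = refl

occ-∷ : ∀ x y ys → occ x (y ∷ ys) ≡ δ x y + occ x ys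
occ-∷ x y ys with x ≟ y
... | yes x≡y = cong length (filter-accept (x ≟_) x≡y)
... | no  x≢y = cong length (filter-reject (x ≟_) x≢y)

occ-++ : ∀ x xs ys → occ x (xs ++ ys) ≡ occ x xs + occ x ys
occ-++ x xs ys = trans (cong length (filter-++ (x ≟_) xs ys)) (length-++ (filter (x ≟_) xs))

occ-replicate : ∀ x c y → occ x (replicate c y) ≡ c * δ x y
occ-replicate x zero    y = refl
occ-replicate x (suc c) y = trans (occ-∷ x y (replicate c y)) (cong (δ x y +_) (occ-replicate x c y))

occ-concat-replicate : ∀ x c xs → occ x (concat (replicate c xs)) ≡ c * occ x xs
occ-concat-replicate x zero    xs = refl
occ-concat-replicate x (suc c) xs =
  trans (occ-++ x xs _) (cong (occ x xs +_) (occ-concat-replicate x c xs))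

∉⇒occ≡0 : ∀ {x} xs → x ∉ xs → occ x xs ≡ 0
∉⇒occ≡0     []       _   = refl
∉⇒occ≡0 {x} (y ∷ ys) x∉ =
  trans (occ-∷ x y ys) (cong₂ _+_ (δ-≢ (x∉ ∘ here)) (∉⇒occ≡0 ys (x∉ ∘ there)))

∈⇒occ>0 : ∀ {x xs} → x ∈ xs → 0 < occ x xs
∈⇒occ>0 {x} {_ ∷ ys} (here refl) rewrite occ-∷ x x ys | δ-diag x = z<s
∈⇒occ>0 {x} {y ∷ ys} (there x∈)  rewrite occ-∷ x y ys = <-≤-trans (∈⇒occ>0 x∈) (m≤n+m _ (δ x y))

occ≢0⇒∈ : ∀ {x} xs → occ x xs ≢ 0 → x ∈ xs
occ≢0⇒∈ {x} xs occ≢0 with x ∈? xs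
... | yes x∈ = x∈
... | no  x∉ = contradiction (∉⇒occ≡0 xs x∉) occ≢0

-- Sums and products over the range [0, N)

∑< : ℕ → (ℕ → ℕ) → ℕ
∑< zero    f = 0
∑< (suc N) f = ∑< N f + f N

∏< : ℕ → (ℕ → ℕ) → ℕ
∏< zero    f = 1
∏< (suc N) f = ∏< N f * f N

∑<-cong : ∀ N {f g} → (∀ x → f x ≡ g x) → ∑< N f ≡ ∑< N g
∑<-cong zero    f≡g = refl
∑<-cong (suc N) f≡g = cong₂ _+_ (∑<-cong N f≡g) (f≡g N)

∏<-cong : ∀ N {f g} → (∀ x → f x ≡ g x) → ∏< N f ≡ ∏< N g
∏<-cong zero    f≡g = refl
∏<-cong (suc N) f≡g = cong₂ _*_ (∏<-cong N f≡g) (f≡g N)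

∑<-+ : ∀ N f g → ∑< N (λ x → f x + g x) ≡ ∑< N f + ∑< N g
∑<-+ zero    f g = refl
∑<-+ (suc N) f g = trans (cong (_+ (f N + g N)) (∑<-+ N f g)) (+-interchange (∑< N f) (∑< N g) (f N) (g N))

∏<-* : ∀ N f g → ∏< N (λ x → f x * g x) ≡ ∏< N f * ∏< N g
∏<-* zero    f g = refl
∏<-* (suc N) f g = trans (cong (_* (f N * g N)) (∏<-* N f g)) (*-interchange (∏< N f) (∏< N g) (f N) (g N))

^-distribʳ-* : ∀ a b c → (a * b) ^ c ≡ a ^ c * b ^ c
^-distribʳ-* a b zero    = refl
^-distribʳ-* a b (suc c) = trans (cong (a * b *_) (^-distribʳ-* a b c)) (*-interchange a b (a ^ c) (b ^ c))

∏<-^ : ∀ N f c → ∏< N (λ x → f x ^ c) ≡ ∏< N f ^ c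
∏<-^ zero    f c = sym (^-zeroˡ c)
∏<-^ (suc N) f c = trans (cong (_* f N ^ c) (∏<-^ N f c)) (sym (^-distribʳ-* (∏< N f) (f N) c))

∑<-zeros : ∀ N {f} → (∀ x → x < N → f x ≡ 0) → ∑< N f ≡ 0
∑<-zeros zero    f≡0 = refl
∑<-zeros (suc N) f≡0 = cong₂ _+_ (∑<-zeros N (λ x → f≡0 x ∘ m<n⇒m<1+n)) (f≡0 N ≤-refl)

∏<-ones : ∀ N {f} → (∀ x → x < N → f x ≡ 1) → ∏< N f ≡ 1
∏<-ones zero    f≡1 = refl
∏<-ones (suc N) f≡1 = cong₂ _*_ (∏<-ones N (λ x → f≡1 x ∘ m<n⇒m<1+n)) (f≡1 N ≤-refl)

∑<-single : ∀ N {f y} → (∀ x → x ≢ y → f x ≡ 0) → y < N → ∑< N f ≡ f y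
∑<-single (suc N) {f} {y} f≡0 y<1+N with m≤n⇒m<n∨m≡n (s≤s⁻¹ y<1+N)
... | inj₁ y<N  = trans (cong₂ _+_ (∑<-single N f≡0 y<N) (f≡0 N (>⇒≢ y<N))) (+-identityʳ (f y))
... | inj₂ refl = cong (_+ f y) (∑<-zeros y (λ x x<y → f≡0 x (<⇒≢ x<y)))

∏<-single : ∀ N {f y} → (∀ x → x ≢ y → f x ≡ 1) → y < N → ∏< N f ≡ f y
∏<-single (suc N) {f} {y} f≡1 y<1+N with m≤n⇒m<n∨m≡n (s≤s⁻¹ y<1+N)
... | inj₁ y<N  = trans (cong₂ _*_ (∏<-single N f≡1 y<N) (f≡1 N (>⇒≢ y<N))) (*-identityʳ (f y))
... | inj₂ refl = trans (cong (_* f y) (∏<-ones y (λ x x<y → f≡1 x (<⇒≢ x<y)))) (*-identityˡ (f y))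

∑<-≤ : ∀ N {f c} → (∀ x → f x ≤ c) → ∑< N f ≤ N * c
∑<-≤ zero    f≤c = z≤n
∑<-≤ (suc N) {f} {c} f≤c = subst (∑< N f + f N ≤_) (+-comm (N * c) c) (+-mono-≤ (∑<-≤ N f≤c) (f≤c N))

∏<-≢0 : ∀ N {f} → (∀ x → f x ≢ 0) → ∏< N f ≢ 0
∏<-≢0 zero    f≢0 ()
∏<-≢0 (suc N) f≢0 eq with m*n≡0⇒m≡0∨n≡0 (∏< N _) eq
... | inj₁ ∏≡0 = ∏<-≢0 N f≢0 ∏≡0
... | inj₂ fN≡0 = f≢0 N fN≡0

-- Sorted lists with prescribed multiplicities

fromCounts : ℕ → (ℕ → ℕ) → List ℕ
fromCounts zero    c = []
fromCounts (suc N) c = fromCounts N c ++ replicate (c N) N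

fromCounts-< : ∀ N c → All (_< N) (fromCounts N c)
fromCounts-< zero    c = []
fromCounts-< (suc N) c = All.++⁺ (All.map m<n⇒m<1+n (fromCounts-< N c)) (All.replicate⁺ (c N) ≤-refl)

fromCounts-sorted : ∀ N c → Linked _≤_ (fromCounts N c)
fromCounts-sorted N c = AllPairs⇒Linked (ordered N)
  where
    replicate-ordered : ∀ r x → AllPairs _≤_ (replicate r x)
    replicate-ordered zero    x = []
    replicate-ordered (suc r) x = All.replicate⁺ r ≤-refl ∷ replicate-ordered r x
    ordered : ∀ N → AllPairs _≤_ (fromCounts N c)
    ordered zero    = []
    ordered (suc N) = AllPairs.++⁺ (ordered N) (replicate-ordered (c N) N)
      (All.map (λ y<N → All.replicate⁺ (c N) (<⇒≤ y<N)) (fromCounts-< N c))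

occ-fromCounts : ∀ N c {x} → x < N → occ x (fromCounts N c) ≡ c x
occ-fromCounts (suc N) c {x} x<1+N with m≤n⇒m<n∨m≡n (s≤s⁻¹ x<1+N)
... | inj₁ x<N = begin
  occ x (fromCounts N c ++ replicate (c N) N)         ≡⟨ occ-++ x (fromCounts N c) _ ⟩
  occ x (fromCounts N c) + occ x (replicate (c N) N)
    ≡⟨ cong₂ _+_ (occ-fromCounts N c x<N) (occ-replicate x (c N) N) ⟩
  c x + c N * δ x N                                   ≡⟨ cong (λ d → c x + c N * d) (δ-≢ (<⇒≢ x<N)) ⟩
  c x + c N * 0                                       ≡⟨ cong (c x +_) (*-zeroʳ (c N)) ⟩
  c x + 0                                             ≡⟨ +-identityʳ (c x) ⟩
  c x                                                 ∎
  where open ≡-Reasoning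
... | inj₂ refl = begin
  occ x (fromCounts x c ++ replicate (c x) x)         ≡⟨ occ-++ x (fromCounts x c) _ ⟩
  occ x (fromCounts x c) + occ x (replicate (c x) x)
    ≡⟨ cong₂ _+_ (∉⇒occ≡0 _ x∉) (occ-replicate x (c x) x) ⟩
  c x * δ x x                                         ≡⟨ cong (c x *_) (δ-diag x) ⟩
  c x * 1                                             ≡⟨ *-identityʳ (c x) ⟩
  c x                                                 ∎
  where
    open ≡-Reasoning
    x∉ : x ∉ fromCounts x c
    x∉ x∈ = <-irrefl refl (All.lookup (fromCounts-< x c) x∈)

product-replicate : ∀ c x → product (replicate c x) ≡ x ^ c
product-replicate zero    x = refl
product-replicate (suc c) x = cong (x *_) (product-replicate c x)

product-concat-replicate : ∀ c xs → product (concat (replicate c xs)) ≡ product xs ^ c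
product-concat-replicate zero    xs = refl
product-concat-replicate (suc c) xs =
  trans (product-++ xs _) (cong (product xs *_) (product-concat-replicate c xs))

product-fromCounts : ∀ N c → product (fromCounts N c) ≡ ∏< N (λ x → x ^ c x)
product-fromCounts zero    c = refl
product-fromCounts (suc N) c = trans (product-++ (fromCounts N c) (replicate (c N) N))
  (cong₂ _*_ (product-fromCounts N c) (product-replicate (c N) N))

length≡∑occ : ∀ N {xs} → All (_< N) xs → length xs ≡ ∑< N (λ x → occ x xs)
length≡∑occ N []                = sym (∑<-zeros N (λ _ _ → refl))
length≡∑occ N {y ∷ ys} (y<N ∷ ys<N) = sym (begin
  ∑< N (λ x → occ x (y ∷ ys))               ≡⟨ ∑<-cong N (λ x → occ-∷ x y ys) ⟩
  ∑< N (λ x → δ x y + occ x ys)             ≡⟨ ∑<-+ N (λ x → δ x y) (λ x → occ x ys) ⟩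
  ∑< N (λ x → δ x y) + ∑< N (λ x → occ x ys)
    ≡⟨ cong₂ _+_ (∑<-single N (λ _ → δ-≢) y<N) (sym (length≡∑occ N ys<N)) ⟩
  δ y y + length ys                          ≡⟨ cong (_+ length ys) (δ-diag y) ⟩
  suc (length ys)                            ∎)
  where open ≡-Reasoning

product≡∏occ : ∀ N {xs} → All (_< N) xs → product xs ≡ ∏< N (λ x → x ^ occ x xs)
product≡∏occ N []                = sym (∏<-ones N (λ _ _ → refl))
product≡∏occ N {y ∷ ys} (y<N ∷ ys<N) = sym (begin
  ∏< N (λ x → x ^ occ x (y ∷ ys))                    ≡⟨ ∏<-cong N (λ x → cong (x ^_) (occ-∷ x y ys)) ⟩
  ∏< N (λ x → x ^ (δ x y + occ x ys))                ≡⟨ ∏<-cong N (λ x → ^-distribˡ-+-* x (δ x y) _) ⟩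
  ∏< N (λ x → x ^ δ x y * x ^ occ x ys)              ≡⟨ ∏<-* N (λ x → x ^ δ x y) (λ x → x ^ occ x ys) ⟩
  ∏< N (λ x → x ^ δ x y) * ∏< N (λ x → x ^ occ x ys)
    ≡⟨ cong₂ _*_ (∏<-single N (λ x x≢y → cong (x ^_) (δ-≢ x≢y)) y<N) (sym (product≡∏occ N ys<N)) ⟩
  y ^ δ y y * product ys                             ≡⟨ cong (λ e → y ^ e * product ys) (δ-diag y) ⟩
  y * 1 * product ys                                 ≡⟨ cong (_* product ys) (*-identityʳ y) ⟩
  y * product ys                                     ∎)
  where open ≡-Reasoning

-- Endpoints of sorted lists

head-≤ : ∀ {a xs} → Linked _≤_ xs → head xs ≡ just a → All (a ≤_) xs
head-≤ {xs = x ∷ xs} sorted eq with just-injective eq | Linked⇒AllPairs ≤-trans sorted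
... | refl | x≤xs ∷ _ = ≤-refl ∷ x≤xs

last-≥ : ∀ {b xs} → Linked _≤_ xs → last xs ≡ just b → All (_≤ b) xs
last-≥ [-] eq with just-injective eq
... | refl = ≤-refl ∷ []
last-≥ (x≤y ∷ sorted) eq with last-≥ sorted eq
... | y≤b ∷ ys≤b = ≤-trans x≤y y≤b ∷ y≤b ∷ ys≤b

head∈ : ∀ {A : Set} {a : A} {xs} → head xs ≡ just a → a ∈ xs
head∈ {xs = x ∷ xs} eq with just-injective eq
... | refl = here refl

last∈ : ∀ {A : Set} {b : A} xs → last xs ≡ just b → b ∈ xs
last∈ (x ∷ [])     eq with just-injective eq
... | refl = here refl
last∈ (x ∷ y ∷ ys) eq = there (last∈ (y ∷ ys) eq)

∈⇒head : ∀ {A : Set} {y : A} {xs} → y ∈ xs → ∃ λ a → head xs ≡ just a × a ∈ xs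
∈⇒head {xs = x ∷ _} _ = x , refl , here refl

last-max : ∀ {n xs} → Linked _≤_ xs → n ∈ xs → All (_≤ n) xs → last xs ≡ just n
last-max [-]           (here refl) _                 = refl
last-max (n≤y ∷ sorted) (here refl) (_ ∷ y≤n ∷ ys≤n) =
  last-max sorted (here (≤-antisym n≤y y≤n)) (y≤n ∷ ys≤n)
last-max (_ ∷ sorted)   (there n∈)  (_ ∷ ys≤n)       = last-max sorted n∈ ys≤n

-- m-th powers

IsPower : ℕ → ℕ → Set
IsPower m a = ∃ λ r → a ≡ r ^ m

IsPower-* : ∀ {m a b} → IsPower m a → IsPower m b → IsPower m (a * b)
IsPower-* {m} (r , refl) (s , refl) = r * s , sym (^-distribʳ-* r s m)

IsPower-^ : ∀ {m a} c → IsPower m a → IsPower m (a ^ c)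
IsPower-^ {m} c (r , refl) = r ^ c , (begin
  (r ^ m) ^ c ≡⟨ ^-*-assoc r m c ⟩
  r ^ (m * c) ≡⟨ cong (r ^_) (*-comm m c) ⟩
  r ^ (c * m) ≡⟨ ^-*-assoc r c m ⟨
  (r ^ c) ^ m ∎)
  where open ≡-Reasoning

coprime-∣^⇒∣1 : ∀ {q s} → Coprime q s → ∀ j → q ∣ s ^ j → q ∣ 1
coprime-∣^⇒∣1 q⊥s zero    q∣1     = q∣1
coprime-∣^⇒∣1 q⊥s (suc j) q∣s^1+j = coprime-∣^⇒∣1 q⊥s j (coprime-divisor q⊥s q∣s^1+j)

IsPower-cancel : ∀ m {a q} → q ≢ 0 → IsPower m (a * q ^ m) → IsPower m a
IsPower-cancel zero {a} _ (_ , eq) = 0 , trans (sym (*-identityʳ a)) eq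
IsPower-cancel m@(suc m-1) {a} {q} q≢0 (r , eq) = r′ , a≡r′^m
  where
    -- dividing q and r by their gcd makes them coprime, so q′ ∣ r′ ^ m forces q′ = 1
    open ≡-Reasoning
    g = gcd q r
    instance
      g≢0 : NonZero g
      g≢0 = ≢-nonZero (gcd[m,n]≢0 q r (inj₁ q≢0))
      gᵐ≢0 : NonZero (g ^ m)
      gᵐ≢0 = m^n≢0 g m
    q′ r′ : ℕ
    q′ = q / g
    r′ = r / g
    a*q′^m≡r′^m : a * q′ ^ m ≡ r′ ^ m
    a*q′^m≡r′^m = *-cancelʳ-≡ _ _ (g ^ m) (begin
      a * q′ ^ m * g ^ m   ≡⟨ *-assoc a (q′ ^ m) (g ^ m) ⟩
      a * (q′ ^ m * g ^ m) ≡⟨ cong (a *_) (^-distribʳ-* q′ g m) ⟨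
      a * (q′ * g) ^ m     ≡⟨ cong (λ z → a * z ^ m) (m/n*n≡m (gcd[m,n]∣m q r)) ⟩
      a * q ^ m            ≡⟨ eq ⟩
      r ^ m                ≡⟨ cong (_^ m) (m/n*n≡m (gcd[m,n]∣n q r)) ⟨
      (r′ * g) ^ m         ≡⟨ ^-distribʳ-* r′ g m ⟩
      r′ ^ m * g ^ m       ∎)
    q′≡1 : q′ ≡ 1
    q′≡1 = ∣1⇒≡1 (coprime-∣^⇒∣1 (coprime-/gcd q r) m
      (∣-trans (m∣m*n (q′ ^ m-1)) (divides a (sym a*q′^m≡r′^m))))
    a≡r′^m : a ≡ r′ ^ m
    a≡r′^m = begin
      a          ≡⟨ *-identityʳ a ⟨
      a * 1      ≡⟨ cong (a *_) (^-zeroˡ m) ⟨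
      a * 1 ^ m  ≡⟨ cong (λ z → a * z ^ m) q′≡1 ⟨
      a * q′ ^ m ≡⟨ a*q′^m≡r′^m ⟩
      r′ ^ m     ∎

∏<-^-divMod : ∀ m .{{_ : NonZero m}} N (e : ℕ → ℕ) →
  ∏< N (λ x → x ^ e x) ≡ ∏< N (λ x → x ^ (e x % m)) * ∏< N (λ x → x ^ (e x / m)) ^ m
∏<-^-divMod m N e = begin
  ∏< N (λ x → x ^ e x)                                        ≡⟨ ∏<-cong N split ⟩
  ∏< N (λ x → x ^ (e x % m) * (x ^ (e x / m)) ^ m)             ≡⟨ ∏<-* N _ _ ⟩
  ∏< N (λ x → x ^ (e x % m)) * ∏< N (λ x → (x ^ (e x / m)) ^ m)
    ≡⟨ cong (∏< N (λ x → x ^ (e x % m)) *_) (∏<-^ N _ m) ⟩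
  ∏< N (λ x → x ^ (e x % m)) * ∏< N (λ x → x ^ (e x / m)) ^ m   ∎
  where
    open ≡-Reasoning
    split : ∀ x → x ^ e x ≡ x ^ (e x % m) * (x ^ (e x / m)) ^ m
    split x = begin
      x ^ e x                            ≡⟨ cong (x ^_) (m≡m%n+[m/n]*n (e x) m) ⟩
      x ^ (e x % m + e x / m * m)        ≡⟨ ^-distribˡ-+-* x (e x % m) _ ⟩
      x ^ (e x % m) * x ^ (e x / m * m)  ≡⟨ cong (x ^ (e x % m) *_) (^-*-assoc x (e x / m) m) ⟨
      x ^ (e x % m) * (x ^ (e x / m)) ^ m ∎

-- Reducing multiplicities modulo m

residue : (m : ℕ) .{{_ : NonZero m}} → ℕ → List ℕ → List ℕ
residue m N xs = fromCounts N (λ x → occ x xs % m)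

residue-IsProdSeq : ∀ m .{{_ : NonZero m}} N {xs} → All (_< N) xs → 0 ∉ xs →
                    IsPower m (product xs) → IsProdSeq m (residue m N xs)
residue-IsProdSeq m N {xs} xs<N 0∉xs xs-power = record
  { sorted = fromCounts-sorted N counts
  ; power  = IsPower-cancel m (∏<-≢0 N base≢0) (subst (IsPower m) product-split xs-power)
  ; mult   = mult
  }
  where
    open ≡-Reasoning
    counts : ℕ → ℕ
    counts x = occ x xs % m
    ys = residue m N xs
    Q = ∏< N (λ x → x ^ (occ x xs / m))
    product-split : product xs ≡ product ys * Q ^ m
    product-split = begin
      product xs                                   ≡⟨ product≡∏occ N xs<N ⟩
      ∏< N (λ x → x ^ occ x xs)                    ≡⟨ ∏<-^-divMod m N (λ x → occ x xs) ⟩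
      ∏< N (λ x → x ^ counts x) * Q ^ m             ≡⟨ cong (_* Q ^ m) (product-fromCounts N counts) ⟨
      product ys * Q ^ m                           ∎
    -- 0 ∉ xs is what keeps Q nonzero, so that the m-th power can be cancelled
    base≢0 : ∀ x → x ^ (occ x xs / m) ≢ 0
    base≢0 zero    eq = 0≢1+n (begin
      0                   ≡⟨ eq ⟨
      0 ^ (occ 0 xs / m)  ≡⟨ cong (λ c → 0 ^ (c / m)) (∉⇒occ≡0 xs 0∉xs) ⟩
      0 ^ (0 / m)         ≡⟨ cong (0 ^_) (0/n≡0 m) ⟩
      1                   ∎)
    base≢0 (suc x) eq = 0≢1+n (sym (m^n≡0⇒m≡0 (suc x) (occ (suc x) xs / m) eq))
    mult : ∀ x → occ x ys < m
    mult x with x <? N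
    ... | yes x<N = subst (_< m) (sym (occ-fromCounts N counts x<N)) (m%n<n (occ x xs) m)
    ... | no  x≮N =
      subst (_< m) (sym (∉⇒occ≡0 ys (x≮N ∘ All.lookup (fromCounts-< N counts)))) (>-nonZero⁻¹ m)

residue-SeqFromTo : ∀ m .{{_ : NonZero m}} lo n {xs} → All (λ x → 0 < x × x ≤ n) xs →
                    IsPower m (product xs) → (∀ x → x ≤ lo → occ x xs % m ≡ 0) → occ n xs % m ≢ 0 →
                    ∃ λ k → lo < k × SeqFromTo m k n
residue-SeqFromTo m lo n {xs} xs-bounds xs-power low top =
  k , above-lo k∈ys , ys , ys-seq , head≡k , last-max (IsProdSeq.sorted ys-seq) n∈ys (All.map s≤s⁻¹ ys<1+n)
  where
    ys = residue m (suc n) xs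
    ys<1+n = fromCounts-< (suc n) (λ x → occ x xs % m)
    ys-seq : IsProdSeq m ys
    ys-seq = residue-IsProdSeq m (suc n) (All.map (s≤s ∘ proj₂) xs-bounds)
      (n≮0 ∘ proj₁ ∘ All.lookup xs-bounds) xs-power
    occ-ys : ∀ {x} → x ≤ n → occ x ys ≡ occ x xs % m
    occ-ys x≤n = occ-fromCounts (suc n) _ (s≤s x≤n)
    n∈ys : n ∈ ys
    n∈ys = occ≢0⇒∈ ys (top ∘ trans (sym (occ-ys ≤-refl)))
    above-lo : ∀ {y} → y ∈ ys → lo < y
    above-lo {y} y∈ys = ≰⇒> λ y≤lo → >⇒≢ (∈⇒occ>0 y∈ys)
      (trans (occ-ys (s≤s⁻¹ (All.lookup ys<1+n y∈ys))) (low y y≤lo))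
    k = proj₁ (∈⇒head n∈ys)
    head≡k = proj₁ (proj₂ (∈⇒head n∈ys))
    k∈ys = proj₂ (proj₂ (∈⇒head n∈ys))

seq-bounds : ∀ {m a b} (sq : SeqFromTo m a b) → All (λ x → a ≤ x × x ≤ b) (proj₁ sq)
seq-bounds (_ , xs-seq , head≡a , last≡b) =
  All.zip (head-≤ (IsProdSeq.sorted xs-seq) head≡a , last-≥ (IsProdSeq.sorted xs-seq) last≡b)

seq-≤ : ∀ {m a b} → SeqFromTo m a b → a ≤ b
seq-≤ sq@(_ , _ , head≡a , _) = proj₂ (All.lookup (seq-bounds sq) (head∈ head≡a))

occ-below-start : ∀ {m a b x} (sq : SeqFromTo m a b) → x < a → occ x (proj₁ sq) ≡ 0
occ-below-start sq x<a = ∉⇒occ≡0 (proj₁ sq) (λ x∈ → <⇒≱ x<a (proj₁ (All.lookup (seq-bounds sq) x∈)))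

occ-above-end : ∀ {m a b x} (sq : SeqFromTo m a b) → b < x → occ x (proj₁ sq) ≡ 0
occ-above-end sq b<x = ∉⇒occ≡0 (proj₁ sq) (λ x∈ → <⇒≱ b<x (proj₂ (All.lookup (seq-bounds sq) x∈)))

prime∤* : ∀ {p a b} → Prime p → 0 < a → a < p → 0 < b → b < p → ¬ p ∣ a * b
prime∤* {a = a} {b} p-prime 0<a a<p 0<b b<p p∣ab with euclidsLemma a b p-prime p∣ab
... | inj₁ p∣a = <⇒≱ a<p (∣⇒≤ {{>-nonZero 0<a}} p∣a)
... | inj₂ p∣b = <⇒≱ b<p (∣⇒≤ {{>-nonZero 0<b}} p∣b)

seqTo-factorisation : ∀ m → 1 < m → ∀ {n q d} → n ≡ q * d → 0 < q → q < n → 0 < d → d < n →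
                      ∃ λ k → 0 < k × SeqFromTo m k n
seqTo-factorisation m@(suc m-1) 1<m {n} {q} {d} n≡qd 0<q q<n 0<d d<n =
  residue-SeqFromTo m 0 n bounds (n , product≡n^m) low top
  where
    open ≡-Reasoning
    xs = n ∷ replicate m-1 q ++ replicate m-1 d
    bounds : All (λ x → 0 < x × x ≤ n) xs
    bounds = (<-≤-trans 0<q (<⇒≤ q<n) , ≤-refl)
           ∷ All.++⁺ (All.replicate⁺ m-1 (0<q , <⇒≤ q<n)) (All.replicate⁺ m-1 (0<d , <⇒≤ d<n))
    product≡n^m : product xs ≡ n ^ m
    product≡n^m = begin
      n * product (replicate m-1 q ++ replicate m-1 d) ≡⟨ cong (n *_) (product-++ (replicate m-1 q) _) ⟩
      n * (product (replicate m-1 q) * product (replicate m-1 d))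
        ≡⟨ cong (n *_) (cong₂ _*_ (product-replicate m-1 q) (product-replicate m-1 d)) ⟩
      n * (q ^ m-1 * d ^ m-1) ≡⟨ cong (n *_) (^-distribʳ-* q d m-1) ⟨
      n * (q * d) ^ m-1       ≡⟨ cong (λ z → n * z ^ m-1) n≡qd ⟨
      n ^ m                   ∎
    low : ∀ x → x ≤ 0 → occ x xs % m ≡ 0
    low zero _ = cong (_% m) (∉⇒occ≡0 xs (n≮0 ∘ proj₁ ∘ All.lookup bounds))
    occ-n : occ n xs ≡ 1
    occ-n = begin
      occ n xs ≡⟨ occ-∷ n n _ ⟩
      δ n n + occ n (replicate m-1 q ++ replicate m-1 d)
        ≡⟨ cong₂ _+_ (δ-diag n) (occ-++ n (replicate m-1 q) _) ⟩
      1 + (occ n (replicate m-1 q) + occ n (replicate m-1 d))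
        ≡⟨ cong (1 +_) (cong₂ _+_ (occ-replicate n m-1 q) (occ-replicate n m-1 d)) ⟩
      1 + (m-1 * δ n q + m-1 * δ n d)
        ≡⟨ cong (1 +_) (cong₂ (λ e f → m-1 * e + m-1 * f) (δ-≢ (>⇒≢ q<n)) (δ-≢ (>⇒≢ d<n))) ⟩
      1 + (m-1 * 0 + m-1 * 0) ≡⟨ cong (λ z → 1 + (z + z)) (*-zeroʳ m-1) ⟩
      1 ∎
    top : occ n xs % m ≢ 0
    top eq = 0≢1+n (sym (trans (sym (m<n⇒m%n≡m 1<m)) (trans (cong (_% m) (sym occ-n)) eq)))

seqTo-nonPrime : ∀ m → 1 < m → ∀ {n} → ¬ Prime n → n ≢ 0 → ∃ λ k → 0 < k × SeqFromTo m k n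
seqTo-nonPrime m       1<m {zero}  _ n≢0 = contradiction refl n≢0
seqTo-nonPrime m@(suc _) 1<m {1} _ _ =
  residue-SeqFromTo m 0 1 ((z<s , ≤-refl) ∷ []) (1 , sym (^-zeroˡ m)) low top
  where
    low : ∀ x → x ≤ 0 → occ x (1 ∷ []) % m ≡ 0
    low zero _ = refl
    top : occ 1 (1 ∷ []) % m ≢ 0
    top eq = 0≢1+n (sym (trans (sym (m<n⇒m%n≡m 1<m)) eq))
seqTo-nonPrime m 1<m {n@(suc (suc _))} ¬prime _ with ¬prime⇒composite ¬prime
... | hasNonTrivialDivisor {d} d<n d∣n =
  seqTo-factorisation m 1<m (_∣_.equality d∣n) (<-trans z<s (quotient>1 d∣n d<n)) (quotient-< d∣n)
    (<-trans z<s (nonTrivial⇒n>1 d)) d<n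

-- Decidability

n≤n^m : ∀ n m .{{_ : NonZero m}} → n ≤ n ^ m
n≤n^m zero    m       = z≤n
n≤n^m (suc n) (suc m) = m≤m*n (suc n) (suc n ^ m) {{m^n≢0 (suc n) m}}

IsPower? : ∀ m .{{_ : NonZero m}} a → Dec (IsPower m a)
IsPower? m a = map′ (λ { (r , _ , a≡r^m) → r , a≡r^m })
                    (λ { (r , a≡r^m) → r , s≤s (subst (r ≤_) (sym a≡r^m) (n≤n^m r m)) , a≡r^m })
                    (anyUpTo? (λ r → a ≟ r ^ m) (suc a))

IsProdSeq? : ∀ m .{{_ : NonZero m}} xs → Dec (IsProdSeq m xs)
IsProdSeq? m xs = map′ toRecord fromRecord
  (linked? _≤?_ xs ×-dec IsPower? m (product xs) ×-dec All.all? (λ x → occ x xs <? m) xs)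
  where
    Checks = Linked _≤_ xs × IsPower m (product xs) × All (λ x → occ x xs < m) xs
    toRecord : Checks → IsProdSeq m xs
    toRecord (sorted , power , members-few) = record { sorted = sorted ; power = power ; mult = mult }
      where
        mult : ∀ x → occ x xs < m
        mult x with x ∈? xs
        ... | yes x∈ = All.lookup members-few x∈
        ... | no  x∉ = subst (_< m) (sym (∉⇒occ≡0 xs x∉)) (>-nonZero⁻¹ m)
    fromRecord : IsProdSeq m xs → Checks
    fromRecord p = IsProdSeq.sorted p , IsProdSeq.power p , All.tabulate (λ {x} _ → IsProdSeq.mult p x)

any-boundedList? : ∀ N L {Q : List ℕ → Set} → (∀ xs → Dec (Q xs)) →
                   Dec (∃ λ xs → length xs ≤ L × All (_< N) xs × Q xs)
any-boundedList? N L {Q} Q? with Q? [] | L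
... | yes Q[] | _ = yes ([] , z≤n , [] , Q[])
... | no ¬Q[] | zero = no λ { ([] , _ , _ , Q[]) → ¬Q[] Q[] }
... | no ¬Q[] | suc L with anyUpTo? (λ x → any-boundedList? N L (Q? ∘ (x ∷_))) N
...   | yes (x , x<N , xs , len≤L , xs<N , Qx∷xs) = yes (x ∷ xs , s≤s len≤L , x<N ∷ xs<N , Qx∷xs)
...   | no ¬cons = no λ { ([] , _ , _ , Q[]) → ¬Q[] Q[]
                        ; (x ∷ xs , s≤s len≤L , x<N ∷ xs<N , Qx∷xs) →
                            ¬cons (x , x<N , xs , len≤L , xs<N , Qx∷xs) }

SeqFromTo? : ∀ m .{{_ : NonZero m}} k n → Dec (SeqFromTo m k n)
SeqFromTo? m k n = map′ (λ { (xs , _ , _ , xs-seq) → xs , xs-seq }) bounded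
  (any-boundedList? (suc n) (suc n * m)
    (λ xs → IsProdSeq? m xs ×-dec ≡-dec _≟_ (head xs) (just k) ×-dec ≡-dec _≟_ (last xs) (just n)))
  where
    bounded : (sq : SeqFromTo m k n) → ∃ λ xs → length xs ≤ suc n * m × All (_< suc n) xs × _
    bounded sq@(xs , xs-seq , _) = xs , length≤ , xs<1+n , proj₂ sq
      where
        xs<1+n = All.map (s≤s ∘ proj₂) (seq-bounds sq)
        length≤ : length xs ≤ suc n * m
        length≤ = subst (_≤ suc n * m) (sym (length≡∑occ (suc n) xs<1+n))
                        (∑<-≤ (suc n) (λ x → <⇒≤ (IsProdSeq.mult xs-seq x)))

greatest : ∀ {P : ℕ → Set} → (∀ k → Dec (P k)) → ∀ N {k₀} → P k₀ → k₀ ≤ N →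
           ∃ λ k → P k × (∀ k′ → P k′ → k′ ≤ N → k′ ≤ k)
greatest P? zero    Pk₀ _ = _ , Pk₀ , λ _ _ k′≤0 → ≤-trans k′≤0 z≤n
greatest {P} P? (suc N) Pk₀ k₀≤1+N with P? (suc N)
... | yes P[1+N] = suc N , P[1+N] , λ _ _ k′≤1+N → k′≤1+N
... | no ¬P[1+N] =
  let k , Pk , max = greatest P? N Pk₀ (≤N k₀≤1+N Pk₀)
  in  k , Pk , λ k′ Pk′ k′≤1+N → max k′ Pk′ (≤N k′≤1+N Pk′)
  where
    ≤N : ∀ {j} → j ≤ suc N → P j → j ≤ N
    ≤N j≤1+N Pj with m≤n⇒m<n∨m≡n j≤1+N
    ... | inj₁ j<1+N = s≤s⁻¹ j<1+N
    ... | inj₂ refl  = contradiction Pj ¬P[1+N]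

mix : ℕ → List ℕ → ℕ → List ℕ → List ℕ
mix a xs b ys = concat (replicate a xs) ++ concat (replicate b ys)

occ-mix : ∀ x a xs b ys → occ x (mix a xs b ys) ≡ a * occ x xs + b * occ x ys
occ-mix x a xs b ys = trans (occ-++ x (concat (replicate a xs)) _)
  (cong₂ _+_ (occ-concat-replicate x a xs) (occ-concat-replicate x b ys))

IsPower-mix : ∀ {m xs ys} a b → IsPower m (product xs) → IsPower m (product ys) →
              IsPower m (product (mix a xs b ys))
IsPower-mix {m} {xs} {ys} a b xs-power ys-power = subst (IsPower m) (sym product-mix)
  (IsPower-* {m} (IsPower-^ {m} a xs-power) (IsPower-^ {m} b ys-power))
  where
    product-mix : product (mix a xs b ys) ≡ product xs ^ a * product ys ^ b
    product-mix = trans (product-++ (concat (replicate a xs)) _)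
      (cong₂ _*_ (product-concat-replicate a xs) (product-concat-replicate b ys))

raiseStart : ∀ {m} → Prime m → ∀ {k s n} → 0 < k → s < n →
             SeqFromTo m k s → SeqFromTo m k n → ∃ λ k′ → k < k′ × SeqFromTo m k′ n
raiseStart {m} m-prime {k} {s} {n} 0<k s<n A@(as , as-seq , head-as , _) B@(bs , bs-seq , _ , last-bs) =
  residue-SeqFromTo m k n bounds power low top
  where
    open ≡-Reasoning
    instance
      m≢0 : NonZero m
      m≢0 = prime⇒nonZero m-prime
    c₁ c₂ : ℕ
    c₁ = occ k as
    c₂ = occ k bs
    xs = mix c₁ bs (m ∸ c₂) as

    bounds : All (λ x → 0 < x × x ≤ n) xs
    bounds = All.++⁺
      (All.concat⁺ (All.replicate⁺ c₁ (All.map (λ (k≤x , x≤n) → <-≤-trans 0<k k≤x , x≤n) (seq-bounds B))))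
      (All.concat⁺ (All.replicate⁺ (m ∸ c₂)
        (All.map (λ (k≤x , x≤s) → <-≤-trans 0<k k≤x , ≤-trans x≤s (<⇒≤ s<n)) (seq-bounds A))))

    power : IsPower m (product xs)
    power = IsPower-mix {m} c₁ (m ∸ c₂) (IsProdSeq.power bs-seq) (IsProdSeq.power as-seq)
    occ-xs : ∀ x → occ x xs ≡ c₁ * occ x bs + (m ∸ c₂) * occ x as
    occ-xs x = occ-mix x c₁ bs (m ∸ c₂) as
    occ-k : occ k xs ≡ c₁ * m
    occ-k = begin
      occ k xs                ≡⟨ occ-xs k ⟩
      c₁ * c₂ + (m ∸ c₂) * c₁ ≡⟨ cong (c₁ * c₂ +_) (*-comm (m ∸ c₂) c₁) ⟩
      c₁ * c₂ + c₁ * (m ∸ c₂) ≡⟨ *-distribˡ-+ c₁ c₂ (m ∸ c₂) ⟨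
      c₁ * (c₂ + (m ∸ c₂))    ≡⟨ cong (c₁ *_) (m+[n∸m]≡n (<⇒≤ (IsProdSeq.mult bs-seq k))) ⟩
      c₁ * m                  ∎
    low : ∀ x → x ≤ k → occ x xs % m ≡ 0
    low x x≤k with m≤n⇒m<n∨m≡n x≤k
    ... | inj₂ refl = trans (cong (_% m) occ-k) (m*n%n≡0 c₁ m)
    ... | inj₁ x<k  = trans (cong (_% m) (begin
      occ x xs                              ≡⟨ occ-xs x ⟩
      c₁ * occ x bs + (m ∸ c₂) * occ x as
        ≡⟨ cong₂ (λ u v → c₁ * u + (m ∸ c₂) * v) (occ-below-start B x<k) (occ-below-start A x<k) ⟩
      c₁ * 0 + (m ∸ c₂) * 0                 ≡⟨ cong₂ _+_ (*-zeroʳ c₁) (*-zeroʳ (m ∸ c₂)) ⟩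
      0                                     ∎)) (m*n%n≡0 0 m)

    occ-n : occ n xs ≡ c₁ * occ n bs
    occ-n = begin
      occ n xs                            ≡⟨ occ-xs n ⟩
      c₁ * occ n bs + (m ∸ c₂) * occ n as
        ≡⟨ cong (λ v → c₁ * occ n bs + (m ∸ c₂) * v) (occ-above-end A s<n) ⟩
      c₁ * occ n bs + (m ∸ c₂) * 0        ≡⟨ cong (c₁ * occ n bs +_) (*-zeroʳ (m ∸ c₂)) ⟩
      c₁ * occ n bs + 0                   ≡⟨ +-identityʳ _ ⟩
      c₁ * occ n bs                       ∎
    top : occ n xs % m ≢ 0
    top occ-n%m≡0 = prime∤* m-prime
      (∈⇒occ>0 (head∈ head-as)) (IsProdSeq.mult as-seq k)
      (∈⇒occ>0 (last∈ bs last-bs)) (IsProdSeq.mult bs-seq n)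
      (m%n≡0⇒n∣m _ m (trans (cong (_% m) (sym occ-n)) occ-n%m≡0))

lemma5p4 : (m n : ℕ) → Prime m → ¬ Prime n → n ≢ 0 →
    ∃ λ k → IsGbar m n k × IsG m k n
lemma5p4 m n m-prime ¬n-prime n≢0 = k , (seq-k , greatest-k) , (seq-k , least-n)
  where
    instance
      m≢0 : NonZero m
      m≢0 = prime⇒nonZero m-prime
    start = seqTo-nonPrime m (nonTrivial⇒n>1 m {{prime⇒nonTrivial m-prime}}) ¬n-prime n≢0
    k₀ = proj₁ start
    0<k₀ = proj₁ (proj₂ start)
    seq-k₀ = proj₂ (proj₂ start)
    best = greatest (λ j → SeqFromTo? m j n) n seq-k₀ (seq-≤ seq-k₀)
    k = proj₁ best
    seq-k = proj₁ (proj₂ best)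
    greatest-k : ∀ k′ → SeqFromTo m k′ n → k′ ≤ k
    greatest-k k′ seq-k′ = proj₂ (proj₂ best) k′ seq-k′ (seq-≤ seq-k′)
    least-n : ∀ s → SeqFromTo m k s → n ≤ s
    least-n s seq-ks = ≮⇒≥ λ s<n →
      let k′ , k<k′ , seq-k′ = raiseStart m-prime (<-≤-trans 0<k₀ (greatest-k k₀ seq-k₀)) s<n seq-ks seq-k
      in  <⇒≱ k<k′ (greatest-k k′ seq-k′)
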